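{- Let $n\ge 3$, let $F$ be a forest on $n$ vertices and $G$ a graph on $n$ vertices that is not a forest, and suppose $F$ and $G$ have at least $\lfloor n/2\rfloor+1$ common cards. Then $\kappa_F\le \kappa_G+1$, where $\kappa_X$ denotes the number of connected components of $X$.
   Context: All graphs are finite and simple. For a graph $X$ and a vertex $v$, the card $X-v$ is the unlabeled graph obtained by deleting $v$ and its incident edges; the deck of $X$ is the multiset $\{X-v : v\in V(X)\}$. The number of common cards of two graphs $X,Y$ on the same number of vertices is the size of the multiset intersection of their decks, i.e. the largest $m$ such that there are distinct vertices $x_1,\dots,x_m$ of $X$ and distinct vertices $y_1,\dots,y_m$ of $Y$ with $X-x_i\cong Y-y_i$ for all $i$. -}

module Defs where

open import Data.Nat using (ℕ; zero; suc; _+_; _≤_; _≥_; _/_)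
open import Data.Fin using (Fin; punchIn)
open import Data.Bool using (Bool; true; false)
open import Data.List using (List; []; _∷_; length)
open import Data.List.Relation.Unary.Unique.Propositional using (Unique)
open import Data.Product using (Σ; _×_; _,_; ∃)
open import Data.Empty using (⊥)
open import Relation.Nullary using (¬_)
open import Relation.Binary.PropositionalEquality using (_≡_)
open import Function.Bundles using (_↔_; _⇔_)
open import Function.Definitions using (Injective; Surjective)
open import Function.Bundles using (Inverse)

record Graph (n : ℕ) : Set where
  field
    adj   : Fin n → Fin n → Bool
    sym   : ∀ u v → adj u v ≡ adj v u
    irref : ∀ v → adj v v ≡ false

open Graph public

card : ∀ {n} → Graph (suc n) → Fin (suc n) → Graph n
card X v = record
  { adj   = λ a b → adj X (punchIn v a) (punchIn v b)
  ; sym   = λ a b → sym X (punchIn v a) (punchIn v b)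
  ; irref = λ a → irref X (punchIn v a)
  }

_≅_ : ∀ {n} → Graph n → Graph n → Set
_≅_ {n} X Y = Σ (Fin n ↔ Fin n) λ f →
  ∀ u v → adj X u v ≡ adj Y (Inverse.to f u) (Inverse.to f v)

CommonCardsAtLeast : ∀ {n} → ℕ → Graph (suc n) → Graph (suc n) → Set
CommonCardsAtLeast {n} m X Y =
  Σ (Fin m → Fin (suc n)) λ x → Σ (Fin m → Fin (suc n)) λ y →
    Injective _≡_ _≡_ x × Injective _≡_ _≡_ y ×
    (∀ i → card X (x i) ≅ card Y (y i))

IsWalk : ∀ {n} → Graph n → List (Fin n) → Set
IsWalk X []            = Data.Unit.⊤ where import Data.Unit
IsWalk X (u ∷ [])      = Data.Unit.⊤ where import Data.Unit
IsWalk X (u ∷ v ∷ vs)  = adj X u v ≡ true × IsWalk X (v ∷ vs)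

WalkFrom : ∀ {n} → Graph n → Fin n → Fin n → List (Fin n) → Set
WalkFrom X u v []       = ⊥
WalkFrom X u v (w ∷ ws) = u ≡ w × Last w ws × IsWalk X (w ∷ ws)
  where
  Last : Fin _ → List (Fin _) → Set
  Last a []       = a ≡ v
  Last a (b ∷ bs) = Last b bs

Connected : ∀ {n} → Graph n → Fin n → Fin n → Set
Connected X u v = ∃ λ ws → WalkFrom X u v ws

HasComponents : ∀ {n} → Graph n → ℕ → Set
HasComponents {n} X k = Σ (Fin n → Fin k) λ c →
  Surjective _≡_ _≡_ c × (∀ u v → (c u ≡ c v) ⇔ Connected X u v)

IsCycle : ∀ {n} → Graph n → List (Fin n) → Set
IsCycle X []       = ⊥
IsCycle X (v ∷ vs) = 3 ≤ length (v ∷ vs) × Unique (v ∷ vs) ×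
                     IsWalk X (v ∷ vs) × ClosesTo vs
  where
  ClosesTo : List (Fin _) → Set
  ClosesTo []       = ⊥
  ClosesTo (w ∷ []) = adj X w v ≡ true
  ClosesTo (w ∷ ws) = ClosesTo ws

IsForest : ∀ {n} → Graph n → Set
IsForest X = ∀ cs → ¬ IsCycle X cs

-- A forest on n vertices with k components has n − k edges, while a graph with a cycle and k components
-- has at least n − k + 1; so κ_F ≥ κ_G + 2 would force d := e(G) − e(F) ≥ 3. Each common card F − x ≅ G − y
-- gives deg_G y = deg_F x + d, so over the m = ⌊n/2⌋ + 1 matched pairs the matched vertices Y of G have total
-- degree m·d more than the matched vertices X of F. But G − y₀ ≅ F − x₀ is a forest, so
-- Σ_Y deg_G ≤ e(G) + e(G[Y]) ≤ e(G) + 2m − 3, and F is a forest, so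
-- Σ_X deg_F ≥ e(F) − e(F[V ∖ X]) ≥ e(F) − (n − m − 1). As n ≤ 2m − 1 this gives
-- (m − 1)·d ≤ 3(m − 1) − 2, contradicting d ≥ 3.

module Submission where

open import Defs renaming (sym to adj-sym)
open import Data.Bool using (Bool; true; false; not; _∧_; _∨_)
import Data.Bool as B
open import Data.Bool.Properties using (∨-zeroʳ; ∧-identityʳ)
open import Data.Empty using (⊥; ⊥-elim)
open import Data.Fin using (Fin; zero; suc; punchIn; punchOut; fromℕ<; _≟_)
open import Data.Fin.Properties using (any?; punchInᵢ≢i; punchIn-punchOut; punchIn-injective)
open import Data.List using (List; []; _∷_; _++_; length; map)
open import Data.List.Membership.Propositional using (_∈_; _∉_)
open import Data.List.Membership.Propositional.Properties using (∈-∃++)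
open import Data.List.Properties using (length-map; length-++; ++-assoc)
import Data.List.Membership.DecPropositional as DecMembership
open import Data.List.Relation.Unary.All using ([]; _∷_)
open import Data.List.Relation.Unary.All.Properties using (++⁻ˡ; ¬Any⇒All¬)
open import Data.List.Relation.Unary.Any using (here; there)
open import Data.List.Relation.Unary.AllPairs using ([]; _∷_)
open import Data.List.Relation.Unary.Unique.Propositional using (Unique)
open import Data.List.Relation.Unary.Unique.Propositional.Properties using (Unique[x∷xs]⇒x∉xs; map⁺)
open import Data.Nat using (ℕ; zero; suc; _+_; _*_; _∸_; _≤_; _<_; z≤n; s≤s; _/_; _%_; _≤?_)
open import Data.Nat.Properties hiding (_≟_)
open import Algebra.Properties.CommutativeSemigroup +-commutativeSemigroup using (xy∙z≈xz∙y)
open import Algebra.Properties.Semiring.Sum +-*-semiring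
  using (sum; sum-remove; ∑-distrib-+; ∑-comm; sum-permute; sum-cong-≗; *-distribˡ-sum; *-distribʳ-sum)
open import Data.Nat.DivMod using (m≡m%n+[m/n]*n; m%n<n; m/n*n≤m; m≥n⇒m/n>0)
open import Data.Nat.Tactic.RingSolver using (solve-∀)
open import Data.Product using (Σ; _×_; _,_; ∃; proj₁; proj₂)
open import Data.Sum using (_⊎_; inj₁; inj₂)
open import Data.Unit using (tt)
open import Function using (_∘_)
open import Function.Bundles using (Inverse; Injection; Equivalence; _⇔_)
open import Function.Definitions using (Injective)
open import Function.Properties.Inverse using (↔-sym; ↔⇒↣)
open import Relation.Binary.PropositionalEquality
open import Relation.Nullary using (¬_; yes; no; does)
open import Relation.Nullary.Decidable using (_×-dec_)

sum-mono-≤ : ∀ {n} (f g : Fin n → ℕ) → (∀ i → f i ≤ g i) → sum f ≤ sum g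
sum-mono-≤ {zero}  f g f≤g = z≤n
sum-mono-≤ {suc n} f g f≤g = +-mono-≤ (f≤g zero) (sum-mono-≤ (f ∘ suc) (g ∘ suc) (f≤g ∘ suc))

sum-zeros : ∀ {n} (f : Fin n → ℕ) → (∀ i → f i ≡ 0) → sum f ≡ 0
sum-zeros {zero}  f f≡0 = refl
sum-zeros {suc n} f f≡0 = cong₂ _+_ (f≡0 zero) (sum-zeros (f ∘ suc) (f≡0 ∘ suc))

sum-const : ∀ n c → sum {n} (λ _ → c) ≡ n * c
sum-const zero    c = refl
sum-const (suc n) c = cong (c +_) (sum-const n c)

term≤sum : ∀ {n} (f : Fin n → ℕ) i → f i ≤ sum f
term≤sum {suc n} f i = subst (f i ≤_) (sym (sum-remove {i = i} f)) (m≤m+n (f i) _)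

two-terms≤sum : ∀ {n} (f : Fin n → ℕ) {i j} → i ≢ j → f i + f j ≤ sum f
two-terms≤sum {suc n} f {i} {j} i≢j = subst (f i + f j ≤_) (sym (sum-remove {i = i} f))
  (+-monoʳ-≤ (f i) (subst (λ k → f k ≤ sum (f ∘ punchIn i)) (punchIn-punchOut i≢j)
    (term≤sum (f ∘ punchIn i) (punchOut i≢j))))

sum-supported-at : ∀ {n} (f : Fin n → ℕ) i → (∀ j → j ≢ i → f j ≡ 0) → sum f ≡ f i
sum-supported-at {suc n} f i f≡0 = begin
  sum f                          ≡⟨ sum-remove {i = i} f ⟩
  f i + sum (f ∘ punchIn i)      ≡⟨ cong (f i +_) (sum-zeros (f ∘ punchIn i) (λ j → f≡0 _ (punchInᵢ≢i i j))) ⟩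
  f i + 0                        ≡⟨ +-identityʳ (f i) ⟩
  f i                            ∎
  where open ≡-Reasoning

sum≡0⇒term≡0 : ∀ {n} (f : Fin n → ℕ) → sum f ≡ 0 → ∀ i → f i ≡ 0
sum≡0⇒term≡0 f sum≡0 i = n≤0⇒n≡0 (subst (f i ≤_) sum≡0 (term≤sum f i))

sum-positive : ∀ {n} (f : Fin n → ℕ) → 1 ≤ sum f → ∃ λ i → 1 ≤ f i
sum-positive {suc n} f pos with f zero in eq
... | suc _ = zero , subst (1 ≤_) (sym eq) (s≤s z≤n)
... | zero with sum-positive (f ∘ suc) pos
...   | i , fi≥1 = suc i , fi≥1

sum-mono-≤-with-gap : ∀ {n} (f g : Fin n → ℕ) j d → (∀ i → f i ≤ g i) → f j + d ≤ g j →
                      sum f + d ≤ sum g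
sum-mono-≤-with-gap {suc n} f g j d f≤g gap =
  subst₂ (λ a b → a + d ≤ b) (sym (sum-remove {i = j} f)) (sym (sum-remove {i = j} g)) (begin
    f j + sum (f ∘ punchIn j) + d  ≡⟨ xy∙z≈xz∙y (f j) _ d ⟩
    f j + d + sum (f ∘ punchIn j)  ≤⟨ +-mono-≤ gap (sum-mono-≤ (f ∘ punchIn j) (g ∘ punchIn j) (f≤g ∘ punchIn j)) ⟩
    g j + sum (g ∘ punchIn j)      ∎)
  where open ≤-Reasoning

true≢false : true ≢ false
true≢false ()

⟦_⟧ : Bool → ℕ
⟦ true  ⟧ = 1
⟦ false ⟧ = 0

⟦⟧≤1 : ∀ b → ⟦ b ⟧ ≤ 1
⟦⟧≤1 true  = s≤s z≤n
⟦⟧≤1 false = z≤n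

⟦⟧-mono : ∀ {a b} → (a ≡ true → b ≡ true) → ⟦ a ⟧ ≤ ⟦ b ⟧
⟦⟧-mono {true}  a⇒b rewrite a⇒b refl = s≤s z≤n
⟦⟧-mono {false} a⇒b = z≤n

⟦⟧≥1⇒true : ∀ {b} → 1 ≤ ⟦ b ⟧ → b ≡ true
⟦⟧≥1⇒true {true} _ = refl

VertexSet : ℕ → Set
VertexSet n = Fin n → Bool

module _ {n : ℕ} where

  ind : VertexSet n → Fin n → ℕ
  ind S u = ⟦ S u ⟧

  full : VertexSet n
  full _ = true

  ∁ : VertexSet n → VertexSet n
  ∁ S u = not (S u)

  ⁅_⁆ : Fin n → VertexSet n
  ⁅ w ⁆ u = does (u ≟ w)

  remove : Fin n → VertexSet n → VertexSet n
  remove w S u = S u ∧ not (⁅ w ⁆ u)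

  insert : Fin n → VertexSet n → VertexSet n
  insert w S u = S u ∨ ⁅ w ⁆ u

  _⊆_ : VertexSet n → VertexSet n → Set
  S ⊆ T = ∀ u → S u ≡ true → T u ≡ true

  _≐_+⁅_⁆ : VertexSet n → VertexSet n → Fin n → Set
  S ≐ T +⁅ w ⁆ = ∀ u → ind S u ≡ ind T u + ind ⁅ w ⁆ u

  size : VertexSet n → ℕ
  size S = sum (ind S)

  ⁅⁆-self : ∀ w → ⁅ w ⁆ w ≡ true
  ⁅⁆-self w with w ≟ w
  ... | yes _  = refl
  ... | no w≢w = ⊥-elim (w≢w refl)

  ⁅⁆-other : ∀ w u → u ≢ w → ⁅ w ⁆ u ≡ false
  ⁅⁆-other w u u≢w with u ≟ w
  ... | yes u≡w = ⊥-elim (u≢w u≡w)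
  ... | no _    = refl

  ∈⁅⁆ : ∀ w u → ⁅ w ⁆ u ≡ true → u ≡ w
  ∈⁅⁆ w u u∈ with u ≟ w
  ... | yes u≡w = u≡w

  ⁅⁆-comm : ∀ w u → ⁅ w ⁆ u ≡ ⁅ u ⁆ w
  ⁅⁆-comm w u with u ≟ w | w ≟ u
  ... | yes _   | yes _   = refl
  ... | no _    | no _    = refl
  ... | yes u≡w | no w≢u  = ⊥-elim (w≢u (sym u≡w))
  ... | no u≢w  | yes w≡u = ⊥-elim (u≢w (sym w≡u))

sum-⁅⁆ : ∀ {n} (w : Fin n) (f : Fin n → ℕ) → sum (λ u → ind ⁅ w ⁆ u * f u) ≡ f w
sum-⁅⁆ w f = begin
  sum (λ u → ind ⁅ w ⁆ u * f u)  ≡⟨ sum-supported-at _ w (λ u u≢w → cong (λ b → ⟦ b ⟧ * f u) (⁅⁆-other w u u≢w)) ⟩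
  ind ⁅ w ⁆ w * f w              ≡⟨ cong (λ b → ⟦ b ⟧ * f w) (⁅⁆-self w) ⟩
  1 * f w                        ≡⟨ *-identityˡ (f w) ⟩
  f w                            ∎
  where open ≡-Reasoning

size-⁅⁆ : ∀ {n} (w : Fin n) → size ⁅ w ⁆ ≡ 1
size-⁅⁆ w = trans (sum-cong-≗ (λ u → sym (*-identityʳ (ind ⁅ w ⁆ u)))) (sum-⁅⁆ w (λ _ → 1))

size-+⁅⁆ : ∀ {n} {S T : VertexSet n} {w} → S ≐ T +⁅ w ⁆ → size S ≡ size T + 1
size-+⁅⁆ {S = S} {T} {w} S≐ = begin
  size S                                 ≡⟨ sum-cong-≗ S≐ ⟩
  sum (λ u → ind T u + ind ⁅ w ⁆ u)      ≡⟨ ∑-distrib-+ (ind T) (ind ⁅ w ⁆) ⟩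
  size T + size ⁅ w ⁆                    ≡⟨ cong (size T +_) (size-⁅⁆ w) ⟩
  size T + 1                             ∎
  where open ≡-Reasoning

adjℕ : ∀ {n} → Graph n → Fin n → Fin n → ℕ
adjℕ X u w = ⟦ adj X u w ⟧

adjℕ-sym : ∀ {n} (X : Graph n) u w → adjℕ X u w ≡ adjℕ X w u
adjℕ-sym X u w = cong ⟦_⟧ (adj-sym X u w)

adjℕ-irrefl : ∀ {n} (X : Graph n) u → adjℕ X u u ≡ 0
adjℕ-irrefl X u = cong ⟦_⟧ (irref X u)

adjForm : ∀ {n} → Graph n → (Fin n → ℕ) → (Fin n → ℕ) → ℕ
adjForm X p q = sum (λ u → p u * sum (λ w → q w * adjℕ X u w))

deg : ∀ {n} → Graph n → VertexSet n → Fin n → ℕ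
deg X S w = sum (λ u → ind S u * adjℕ X w u)

-- Twice the number of edges of the subgraph of X induced on S.
edgeSum : ∀ {n} → Graph n → VertexSet n → ℕ
edgeSum X S = adjForm X (ind S) (ind S)

module _ {n : ℕ} (X : Graph n) where

  adjForm-cong : ∀ {p p′ q q′} → (∀ u → p u ≡ p′ u) → (∀ u → q u ≡ q′ u) → adjForm X p q ≡ adjForm X p′ q′
  adjForm-cong p≗ q≗ = sum-cong-≗ (λ u → cong₂ _*_ (p≗ u) (sum-cong-≗ (λ w → cong (_* adjℕ X u w) (q≗ w))))

  adjForm-linˡ : ∀ p p′ q → adjForm X (λ u → p u + p′ u) q ≡ adjForm X p q + adjForm X p′ q
  adjForm-linˡ p p′ q = trans (sum-cong-≗ (λ u → *-distribʳ-+ _ (p u) (p′ u)))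
    (∑-distrib-+ (λ u → p u * sum (λ w → q w * adjℕ X u w)) (λ u → p′ u * sum (λ w → q w * adjℕ X u w)))

  adjForm-linʳ : ∀ p q q′ → adjForm X p (λ w → q w + q′ w) ≡ adjForm X p q + adjForm X p q′
  adjForm-linʳ p q q′ = trans (sum-cong-≗ row)
    (∑-distrib-+ (λ u → p u * sum (λ w → q w * adjℕ X u w)) (λ u → p u * sum (λ w → q′ w * adjℕ X u w)))
    where
    row : ∀ u → p u * sum (λ w → (q w + q′ w) * adjℕ X u w) ≡
                p u * sum (λ w → q w * adjℕ X u w) + p u * sum (λ w → q′ w * adjℕ X u w)
    row u = trans (cong (p u *_) (trans (sum-cong-≗ (λ w → *-distribʳ-+ (adjℕ X u w) (q w) (q′ w)))
                                        (∑-distrib-+ (λ w → q w * adjℕ X u w) (λ w → q′ w * adjℕ X u w))))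
                  (*-distribˡ-+ (p u) _ _)

  adjForm-sym : ∀ p q → adjForm X p q ≡ adjForm X q p
  adjForm-sym p q = begin
    sum (λ u → p u * sum (λ w → q w * adjℕ X u w))
      ≡⟨ sum-cong-≗ (λ u → *-distribˡ-sum (p u) (λ w → q w * adjℕ X u w)) ⟩
    sum (λ u → sum (λ w → p u * (q w * adjℕ X u w)))
      ≡⟨ ∑-comm (λ u w → p u * (q w * adjℕ X u w)) ⟩
    sum (λ w → sum (λ u → p u * (q w * adjℕ X u w)))
      ≡⟨ sum-cong-≗ (λ w → sum-cong-≗ (λ u → swap (p u) (q w) (adjℕ-sym X u w))) ⟩
    sum (λ w → sum (λ u → q w * (p u * adjℕ X w u)))
      ≡⟨ sum-cong-≗ (λ w → sym (*-distribˡ-sum (q w) (λ u → p u * adjℕ X w u))) ⟩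
    sum (λ w → q w * sum (λ u → p u * adjℕ X w u))  ∎
    where
    open ≡-Reasoning
    swap : ∀ a b {c d} → c ≡ d → a * (b * c) ≡ b * (a * d)
    swap a b {c} refl = trans (sym (*-assoc a b c)) (trans (cong (_* c) (*-comm a b)) (*-assoc b a c))

  adjForm-⁅⁆ˡ : ∀ w q → adjForm X (ind ⁅ w ⁆) q ≡ sum (λ v → q v * adjℕ X w v)
  adjForm-⁅⁆ˡ w q = sum-⁅⁆ w (λ u → sum (λ v → q v * adjℕ X u v))

  edgeSum-⁅⁆ : ∀ w → edgeSum X ⁅ w ⁆ ≡ 0
  edgeSum-⁅⁆ w = trans (adjForm-⁅⁆ˡ w (ind ⁅ w ⁆)) (trans (sum-⁅⁆ w (adjℕ X w)) (adjℕ-irrefl X w))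

  edgeSum-+⁅⁆ : ∀ {S T w} → S ≐ T +⁅ w ⁆ → edgeSum X S ≡ edgeSum X T + 2 * deg X T w
  edgeSum-+⁅⁆ {S} {T} {w} S≐ = begin
    adjForm X s s
      ≡⟨ adjForm-cong S≐ S≐ ⟩
    adjForm X (λ u → t u + δ u) (λ u → t u + δ u)
      ≡⟨ adjForm-linˡ t δ (λ u → t u + δ u) ⟩
    adjForm X t (λ u → t u + δ u) + adjForm X δ (λ u → t u + δ u)
      ≡⟨ cong₂ _+_ (adjForm-linʳ t t δ) (adjForm-linʳ δ t δ) ⟩
    (adjForm X t t + adjForm X t δ) + (adjForm X δ t + adjForm X δ δ)
      ≡⟨ cong₂ _+_ (cong (adjForm X t t +_) (trans (adjForm-sym t δ) δt)) (cong₂ _+_ δt (edgeSum-⁅⁆ w)) ⟩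
    (adjForm X t t + deg X T w) + (deg X T w + 0)
      ≡⟨ collect (adjForm X t t) (deg X T w) ⟩
    edgeSum X T + 2 * deg X T w ∎
    where
    open ≡-Reasoning
    s = ind S
    t = ind T
    δ = ind ⁅ w ⁆
    δt : adjForm X δ t ≡ deg X T w
    δt = adjForm-⁅⁆ˡ w t
    collect : ∀ a d → (a + d) + (d + 0) ≡ a + 2 * d
    collect = solve-∀

module _ {n : ℕ} (S : VertexSet n) (w : Fin n) where

  remove-≐ : S w ≡ true → S ≐ remove w S +⁅ w ⁆
  remove-≐ w∈S u with u ≟ w
  ... | yes refl rewrite w∈S = refl
  ... | no _ with S u
  ...   | true  = refl
  ...   | false = refl

  insert-≐ : S w ≡ false → insert w S ≐ S +⁅ w ⁆
  insert-≐ w∉S u with u ≟ w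
  ... | yes refl rewrite w∉S = refl
  ... | no _ with S u
  ...   | true  = refl
  ...   | false = refl

  remove-⊆ : remove w S ⊆ S
  remove-⊆ u with S u
  ... | true  = λ _ → refl
  ... | false = λ ()

  insert-⊆ : ∀ {U} → S ⊆ U → U w ≡ true → insert w S ⊆ U
  insert-⊆ {U} S⊆U w∈U u u∈ with S u in u∈S
  ... | true  = S⊆U u u∈S
  ... | false = subst (λ v → U v ≡ true) (sym (∈⁅⁆ w u u∈)) w∈U

  remove-self : remove w S w ≡ false
  remove-self rewrite ⁅⁆-self w with S w
  ... | true  = refl
  ... | false = refl

size≤n : ∀ {n} (S : VertexSet n) → size S ≤ n
size≤n {n} S = subst (size S ≤_) (trans (sum-const n 1) (*-identityʳ n))
  (sum-mono-≤ (ind S) (λ _ → 1) (λ u → ⟦⟧≤1 (S u)))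

size-mono : ∀ {n} {S T : VertexSet n} → S ⊆ T → size S ≤ size T
size-mono {S = S} {T} S⊆T = sum-mono-≤ (ind S) (ind T) (λ u → ⟦⟧-mono (S⊆T u))

size-cong : ∀ {n} {S T : VertexSet n} → (∀ u → S u ≡ T u) → size S ≡ size T
size-cong S≗T = sum-cong-≗ (cong ⟦_⟧ ∘ S≗T)

size-positive : ∀ {n} (S : VertexSet n) → 1 ≤ size S → ∃ λ u → S u ≡ true
size-positive S pos with sum-positive (ind S) pos
... | u , Su≥1 = u , ⟦⟧≥1⇒true Su≥1

∈⇒size-positive : ∀ {n} (S : VertexSet n) {u} → S u ≡ true → 1 ≤ size S
∈⇒size-positive S {u} u∈S = subst (λ b → ⟦ b ⟧ ≤ size S) u∈S (term≤sum (ind S) u)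

module _ {n : ℕ} (X : Graph n) where

  adjℕ≤1 : ∀ u w → adjℕ X u w ≤ 1
  adjℕ≤1 u w = ⟦⟧≤1 (adj X u w)

  deg≤size : ∀ S w → deg X S w ≤ size S
  deg≤size S w = sum-mono-≤ _ (ind S) (λ u → subst (ind S u * adjℕ X w u ≤_) (*-identityʳ (ind S u))
                                                     (*-monoʳ-≤ (ind S u) (adjℕ≤1 w u)))

  deg-mono : ∀ {S T} w → S ⊆ T → deg X S w ≤ deg X T w
  deg-mono {S} {T} w S⊆T = sum-mono-≤ _ _ (λ u → *-monoˡ-≤ (adjℕ X w u) (⟦⟧-mono (S⊆T u)))

  private
    neighbour-term : ∀ S {w u} → S u ≡ true → adj X w u ≡ true → ind S u * adjℕ X w u ≡ 1
    neighbour-term S u∈S wu rewrite u∈S | wu = refl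

  deg-positive : ∀ S {w u} → S u ≡ true → adj X w u ≡ true → 1 ≤ deg X S w
  deg-positive S {w} {u} u∈S wu =
    subst (_≤ deg X S w) (neighbour-term S u∈S wu) (term≤sum (λ v → ind S v * adjℕ X w v) u)

  deg≥2 : ∀ S {w a b} → a ≢ b → S a ≡ true → S b ≡ true → adj X w a ≡ true → adj X w b ≡ true → 2 ≤ deg X S w
  deg≥2 S {w} a≢b a∈S b∈S wa wb = subst₂ (λ i j → i + j ≤ deg X S w) (neighbour-term S a∈S wa) (neighbour-term S b∈S wb)
    (two-terms≤sum (λ v → ind S v * adjℕ X w v) a≢b)

  deg≤1 : ∀ S {w} v → (∀ u → S u ≡ true → adj X w u ≡ true → u ≡ v) → deg X S w ≤ 1
  deg≤1 S {w} v only-v = subst (_≤ 1) (sym (sum-supported-at _ v vanish)) (*-mono-≤ (⟦⟧≤1 (S v)) (adjℕ≤1 w v))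
    where
    vanish : ∀ u → u ≢ v → ind S u * adjℕ X w u ≡ 0
    vanish u u≢v with S u in u∈S | adj X w u in wu
    ... | true  | true  = ⊥-elim (u≢v (only-v u u∈S wu))
    ... | true  | false = refl
    ... | false | _     = refl

  deg-remove-self : ∀ S w → deg X (remove w S) w ≡ deg X S w
  deg-remove-self S w = sum-cong-≗ same-term
    where
    same-term : ∀ u → ind (remove w S) u * adjℕ X w u ≡ ind S u * adjℕ X w u
    same-term u with u ≟ w
    ... | yes refl rewrite adjℕ-irrefl X u = trans (*-zeroʳ ⟦ S u ∧ false ⟧) (sym (*-zeroʳ (ind S u)))
    ... | no _     = cong (λ b → ⟦ b ⟧ * adjℕ X w u) (∧-identityʳ (S u))

  edgeSum-cong : ∀ {S T} → (∀ u → S u ≡ T u) → edgeSum X S ≡ edgeSum X T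
  edgeSum-cong S≗T = adjForm-cong X (cong ⟦_⟧ ∘ S≗T) (cong ⟦_⟧ ∘ S≗T)

  size≡0⇒edgeSum≡0 : ∀ S → size S ≡ 0 → edgeSum X S ≡ 0
  size≡0⇒edgeSum≡0 S empty = sum-zeros _ (λ u → cong (_* deg X S u) (sum≡0⇒term≡0 (ind S) empty u))

fromList : ∀ {n} → List (Fin n) → VertexSet n
fromList []       u = false
fromList (x ∷ xs) u = ⁅ x ⁆ u ∨ fromList xs u

module _ {n : ℕ} where

  fromList⇒∈ : ∀ (xs : List (Fin n)) {u} → fromList xs u ≡ true → u ∈ xs
  fromList⇒∈ (x ∷ xs) {u} u∈ with u ≟ x
  ... | yes u≡x = here u≡x
  ... | no _    = there (fromList⇒∈ xs u∈)

  ∈⇒fromList : ∀ {xs : List (Fin n)} {u} → u ∈ xs → fromList xs u ≡ true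
  ∈⇒fromList {u = u} (here refl) rewrite ⁅⁆-self u = refl
  ∈⇒fromList {x ∷ xs} {u} (there u∈) rewrite ∈⇒fromList u∈ = ∨-zeroʳ (⁅ x ⁆ u)

  ∉⇒fromList : ∀ (xs : List (Fin n)) {u} → u ∉ xs → fromList xs u ≡ false
  ∉⇒fromList xs {u} u∉ with fromList xs u in eq
  ... | true  = ⊥-elim (u∉ (fromList⇒∈ xs eq))
  ... | false = refl

  fromList-∷-≐ : ∀ {x} {xs : List (Fin n)} → x ∉ xs → fromList (x ∷ xs) ≐ fromList xs +⁅ x ⁆
  fromList-∷-≐ {x} {xs} x∉ u with u ≟ x
  ... | yes refl rewrite ∉⇒fromList xs x∉ = refl
  ... | no _     = sym (+-identityʳ _)

  size-fromList : ∀ {xs : List (Fin n)} → Unique xs → size (fromList xs) ≡ length xs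
  size-fromList {[]}     []          = sum-zeros {n} (λ _ → 0) (λ _ → refl)
  size-fromList {x ∷ xs} (x∉ ∷ uniq) = begin
    size (fromList (x ∷ xs))  ≡⟨ size-+⁅⁆ (fromList-∷-≐ (Unique[x∷xs]⇒x∉xs (x∉ ∷ uniq))) ⟩
    size (fromList xs) + 1    ≡⟨ cong (_+ 1) (size-fromList uniq) ⟩
    length xs + 1             ≡⟨ +-comm (length xs) 1 ⟩
    length (x ∷ xs)           ∎
    where open ≡-Reasoning

  length≤n : ∀ {xs : List (Fin n)} → Unique xs → length xs ≤ n
  length≤n {xs} uniq = subst (_≤ n) (size-fromList uniq) (size≤n (fromList xs))

Unique-++⁻ˡ : ∀ {A : Set} (xs : List A) {ys} → Unique (xs ++ ys) → Unique xs
Unique-++⁻ˡ []       _            = []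
Unique-++⁻ˡ (x ∷ xs) (x∉ ∷ uniq) = ++⁻ˡ xs x∉ ∷ Unique-++⁻ˡ xs uniq

IsWalk-++⁻ˡ : ∀ {n} (X : Graph n) xs {ys} → IsWalk X (xs ++ ys) → IsWalk X xs
IsWalk-++⁻ˡ X []           _          = tt
IsWalk-++⁻ˡ X (x ∷ [])     _          = tt
IsWalk-++⁻ˡ X (x ∷ y ∷ xs) (xy , walk) = xy , IsWalk-++⁻ˡ X (y ∷ xs) walk

private
  last-factor : {P Q R T : Set} → (P × Q × R × T) ≡ (P × Q × R × T) → Set
  last-factor {T = T} _ = T

-- The closing-edge condition of IsCycle is local to its definition, so we name its type by unification.
CycleCloses : ∀ {n} → Graph n → Fin n → List (Fin n) → Set
CycleCloses X v L = last-factor (refl {x = IsCycle X (v ∷ L)})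

module _ {n : ℕ} (X : Graph n) {v : Fin n} where

  closes-++ : ∀ L {z} → adj X z v ≡ true → CycleCloses X v (L ++ z ∷ [])
  closes-++ []           zv = zv
  closes-++ (a ∷ [])     zv = zv
  closes-++ (a ∷ b ∷ L)  zv = closes-++ (b ∷ L) zv

  closing-edge : ∀ a b L → CycleCloses X v (a ∷ b ∷ L) → ∃ λ z → z ∈ b ∷ L × adj X z v ≡ true
  closing-edge a b []      bv = b , here refl , bv
  closing-edge a b (c ∷ L) cl with closing-edge b c L cl
  ... | z , z∈ , zv = z , there z∈ , zv

path+chord⇒cycle : ∀ {n} (X : Graph n) e p ys {z} zs → Unique (e ∷ p ∷ ys ++ z ∷ zs) →
                   IsWalk X (e ∷ p ∷ ys ++ z ∷ zs) → adj X z e ≡ true → IsCycle X (e ∷ p ∷ ys ++ z ∷ [])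
path+chord⇒cycle X e p ys {z} zs uniq walk ze =
  s≤s (s≤s (subst (1 ≤_) (sym (length-++ ys)) (m≤n+m 1 (length ys)))) ,
  Unique-++⁻ˡ (e ∷ p ∷ ys ++ z ∷ []) (subst Unique split uniq) ,
  IsWalk-++⁻ˡ X (e ∷ p ∷ ys ++ z ∷ []) (subst (IsWalk X) split walk) ,
  closes-++ X (p ∷ ys) ze
  where
  split : e ∷ p ∷ ys ++ z ∷ zs ≡ (e ∷ p ∷ ys ++ z ∷ []) ++ zs
  split = sym (++-assoc (e ∷ p ∷ ys) (z ∷ []) zs)

module _ {n : ℕ} (X : Graph n) (X-forest : IsForest X) (S : VertexSet n) where

  open DecMembership (_≟_ {n}) using (_∈?_; _∉?_)

  Leaf : Set
  Leaf = ∃ λ w → S w ≡ true × deg X S w ≤ 1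

  private
    -- A path that cannot be extended within S ends at a leaf of S: a second S-neighbour of its end would close a cycle.
    dead-end-leaf : ∀ e rest → Unique (e ∷ rest) → IsWalk X (e ∷ rest) → S e ≡ true →
                    (∀ u → S u ≡ true → adj X e u ≡ true → u ∈ e ∷ rest) → Leaf
    dead-end-leaf e [] _ _ e∈S dead-end = e , e∈S , deg≤1 X S e only-e
      where
      only-e : ∀ u → S u ≡ true → adj X e u ≡ true → u ≡ e
      only-e u u∈S eu with dead-end u u∈S eu
      ... | here u≡e = u≡e
    dead-end-leaf e (p ∷ rest) uniq walk e∈S dead-end = e , e∈S , deg≤1 X S p only-p
      where
      only-p : ∀ u → S u ≡ true → adj X e u ≡ true → u ≡ p
      only-p u u∈S eu with dead-end u u∈S eu
      ... | here refl         = ⊥-elim (true≢false (trans (sym eu) (irref X e)))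
      ... | there (here u≡p)  = u≡p
      ... | there (there u∈)  with ∈-∃++ u∈
      ...   | ys , zs , refl  = ⊥-elim (X-forest _ (path+chord⇒cycle X e p ys zs uniq walk (trans (adj-sym X u e) eu)))

    extend-path : ∀ fuel e rest → n < length (e ∷ rest) + fuel → Unique (e ∷ rest) → IsWalk X (e ∷ rest) →
                  S e ≡ true → Leaf
    extend-path zero e rest long uniq _ _ =
      ⊥-elim (<⇒≱ (subst (n <_) (+-identityʳ _) long) (length≤n uniq))
    extend-path (suc fuel) e rest long uniq walk e∈S
      with any? (λ u → (S u B.≟ true) ×-dec (adj X e u B.≟ true) ×-dec (u ∉? e ∷ rest))
    ... | yes (u , u∈S , eu , u∉) =
      extend-path fuel u (e ∷ rest) (subst (n <_) (+-suc _ fuel) long)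
        (¬Any⇒All¬ _ u∉ ∷ uniq) (trans (adj-sym X u e) eu , walk) u∈S
    ... | no stuck = dead-end-leaf e rest uniq walk e∈S on-path
      where
      on-path : ∀ u → S u ≡ true → adj X e u ≡ true → u ∈ e ∷ rest
      on-path u u∈S eu with u ∈? e ∷ rest
      ... | yes u∈ = u∈
      ... | no u∉  = ⊥-elim (stuck (u , u∈S , eu , u∉))

  forest-leaf : ∀ {u} → S u ≡ true → Leaf
  forest-leaf {u} u∈S = extend-path n u [] ≤-refl ([] ∷ []) tt u∈S

module _ {n : ℕ} (X : Graph n) (X-forest : IsForest X) where

  private
    prune : ∀ S k → size S ≡ suc k → ∃ λ w →
            size (remove w S) ≡ k × edgeSum X S ≡ edgeSum X (remove w S) + 2 * deg X (remove w S) w ×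
            deg X (remove w S) w ≤ 1
    prune S k size≡ with forest-leaf X X-forest S (proj₂ (size-positive S (subst (1 ≤_) (sym size≡) (s≤s z≤n))))
    ... | w , w∈S , leaf =
      w , +-cancelʳ-≡ _ _ _ (trans (sym (size-+⁅⁆ S≐)) (trans size≡ (+-comm 1 k))) ,
      edgeSum-+⁅⁆ X S≐ , ≤-trans (deg-mono X w (remove-⊆ S w)) leaf
      where S≐ = remove-≐ S w w∈S

    bound-by-size : ∀ k S → size S ≡ suc k → edgeSum X S + 2 ≤ 2 * size S
    bound-by-size zero S size≡ with prune S zero size≡
    ... | w , size-T , edgeSum-S , _ = ≤-reflexive (begin
      edgeSum X S + 2                                ≡⟨ cong (_+ 2) edgeSum-S ⟩
      edgeSum X T + 2 * deg X T w + 2                ≡⟨ cong₂ (λ a d → a + 2 * d + 2) (size≡0⇒edgeSum≡0 X T size-T)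
                                                                  (n≤0⇒n≡0 (subst (deg X T w ≤_) size-T (deg≤size X T w))) ⟩
      2                                              ≡⟨ cong (2 *_) (sym size≡) ⟩
      2 * size S                                     ∎)
      where
      open ≡-Reasoning
      T = remove w S
    bound-by-size (suc k) S size≡ with prune S (suc k) size≡
    ... | w , size-T , edgeSum-S , leaf = begin
      edgeSum X S + 2                  ≡⟨ cong (_+ 2) edgeSum-S ⟩
      edgeSum X T + 2 * deg X T w + 2  ≤⟨ +-monoˡ-≤ 2 (+-monoʳ-≤ (edgeSum X T) (*-monoʳ-≤ 2 leaf)) ⟩
      (edgeSum X T + 2) + 2            ≤⟨ +-monoˡ-≤ 2 (bound-by-size k T size-T) ⟩
      2 * size T + 2                   ≡⟨ cong (λ s → 2 * s + 2) size-T ⟩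
      2 * suc k + 2                    ≡⟨ +-comm (2 * suc k) 2 ⟩
      2 + 2 * suc k                    ≡⟨ *-suc 2 (suc k) ⟨
      2 * suc (suc k)                  ≡⟨ cong (2 *_) size≡ ⟨
      2 * size S                       ∎
      where
      open ≤-Reasoning
      T = remove w S

  forest-edgeSum-bound : ∀ S → 1 ≤ size S → edgeSum X S + 2 ≤ 2 * size S
  forest-edgeSum-bound S pos with size S in size≡
  ... | suc k = subst (λ s → edgeSum X S + 2 ≤ 2 * s) size≡ (bound-by-size k S size≡)

fibre : ∀ {n k} → (Fin n → Fin k) → Fin k → VertexSet n
fibre c j u = ⁅ j ⁆ (c u)

sum-size-fibres : ∀ {n k} (c : Fin n → Fin k) → sum (λ j → size (fibre c j)) ≡ n
sum-size-fibres {n} c = begin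
  sum (λ j → sum (λ u → ind ⁅ j ⁆ (c u)))  ≡⟨ ∑-comm (λ j u → ind ⁅ j ⁆ (c u)) ⟩
  sum (λ u → sum (λ j → ind ⁅ j ⁆ (c u)))  ≡⟨ sum-cong-≗ (λ u → sum-cong-≗ (λ j → cong ⟦_⟧ (⁅⁆-comm j (c u)))) ⟩
  sum (λ u → size ⁅ c u ⁆)                  ≡⟨ sum-cong-≗ (λ u → size-⁅⁆ (c u)) ⟩
  sum {n} (λ _ → 1)                         ≡⟨ sum-const n 1 ⟩
  n * 1                                     ≡⟨ *-identityʳ n ⟩
  n                                         ∎
  where open ≡-Reasoning

sum-edgeSum-fibres : ∀ {n k} (X : Graph n) (c : Fin n → Fin k) → (∀ u w → adj X u w ≡ true → c u ≡ c w) →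
                     sum (λ j → edgeSum X (fibre c j)) ≡ edgeSum X full
sum-edgeSum-fibres {n} X c c-edge = begin
  sum (λ j → sum (λ u → e j u * sum (λ w → e j w * adjℕ X u w)))
    ≡⟨ sum-cong-≗ (λ j → sum-cong-≗ (λ u → *-distribˡ-sum (e j u) (λ w → e j w * adjℕ X u w))) ⟩
  sum (λ j → sum (λ u → sum (λ w → e j u * (e j w * adjℕ X u w))))
    ≡⟨ ∑-comm (λ j u → sum (λ w → e j u * (e j w * adjℕ X u w))) ⟩
  sum (λ u → sum (λ j → sum (λ w → e j u * (e j w * adjℕ X u w))))
    ≡⟨ sum-cong-≗ (λ u → ∑-comm (λ j w → e j u * (e j w * adjℕ X u w))) ⟩
  sum (λ u → sum (λ w → sum (λ j → e j u * (e j w * adjℕ X u w))))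
    ≡⟨ sum-cong-≗ (λ u → sum-cong-≗ (λ w → same-fibre u w)) ⟩
  sum {n} (λ u → sum (λ w → adjℕ X u w))
    ≡⟨ sum-cong-≗ (λ u → sym (trans (*-identityˡ _) (sum-cong-≗ {n} (λ w → *-identityˡ (adjℕ X u w))))) ⟩
  edgeSum X full ∎
  where
  open ≡-Reasoning
  e : _ → _ → ℕ
  e j u = ind (fibre c j) u
  same-fibre : ∀ u w → sum (λ j → e j u * (e j w * adjℕ X u w)) ≡ adjℕ X u w
  same-fibre u w with adj X u w in uw
  ... | false = sum-zeros _ (λ j → trans (cong (e j u *_) (*-zeroʳ (e j w))) (*-zeroʳ (e j u)))
  ... | true  = begin
    sum (λ j → e j u * (e j w * 1))  ≡⟨ sum-cong-≗ (λ j → cong (λ b → ⟦ b ⟧ * (e j w * 1)) (⁅⁆-comm j (c u))) ⟩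
    sum (λ j → ind ⁅ c u ⁆ j * (e j w * 1))  ≡⟨ sum-⁅⁆ (c u) (λ j → e j w * 1) ⟩
    e (c u) w * 1  ≡⟨ cong (λ b → ⟦ b ⟧ * 1) (subst (λ x → ⁅ c u ⁆ x ≡ true) (c-edge u w uw) (⁅⁆-self (c u))) ⟩
    1 ∎

private
  middle-factor : {P Q R : Set} → (P × Q × R) ≡ (P × Q × R) → Set
  middle-factor {Q = Q} _ = Q

-- Likewise for the endpoint condition of WalkFrom.
WalkEndsAt : ∀ {n} → Graph n → Fin n → Fin n → Fin n → List (Fin n) → Set
WalkEndsAt X u v w ws = middle-factor (refl {x = WalkFrom X u v (w ∷ ws)})

module _ {n : ℕ} (X : Graph n) (T : VertexSet n) where

  CrossingEdge : Set
  CrossingEdge = ∃ λ x → ∃ λ y → T x ≡ true × T y ≡ false × adj X x y ≡ true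

  private
    walk-crosses : ∀ {u v} w ws → WalkEndsAt X u v w ws → IsWalk X (w ∷ ws) →
                   T w ≡ true → T v ≡ false → CrossingEdge
    walk-crosses w []         w≡v _            w∈T v∉T =
      ⊥-elim (true≢false (trans (sym w∈T) (trans (cong T w≡v) v∉T)))
    walk-crosses {u} w (w′ ∷ ws) ends (ww′ , walk) w∈T v∉T with T w′ in w′∈?T
    ... | false = w , w′ , w∈T , w′∈?T , ww′
    ... | true  = walk-crosses {u} w′ ws ends walk w′∈?T v∉T

  connected-crossing-edge : ∀ {u v} → Connected X u v → T u ≡ true → T v ≡ false → CrossingEdge
  connected-crossing-edge {u} (w ∷ ws , refl , ends , walk) = walk-crosses {u} w ws ends walk

  insert-neighbour : ∀ {x y} → T x ≡ true → T y ≡ false → adj X y x ≡ true →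
                     size (insert y T) ≡ size T + 1 × edgeSum X T + 2 ≤ edgeSum X (insert y T)
  insert-neighbour {x} {y} x∈T y∉T yx =
    size-+⁅⁆ (insert-≐ T y y∉T) ,
    subst (edgeSum X T + 2 ≤_) (sym (edgeSum-+⁅⁆ X (insert-≐ T y y∉T)))
      (+-monoʳ-≤ (edgeSum X T) (*-monoʳ-≤ 2 (deg-positive X T x∈T yx)))

module _ {n : ℕ} (X : Graph n) where

  private
    cons-size : ∀ {x} {xs : List (Fin n)} → x ∉ xs → size (fromList (x ∷ xs)) ≡ size (fromList xs) + 1
    cons-size {x} {xs} x∉ = size-+⁅⁆ (fromList-∷-≐ {x = x} {xs} x∉)

    cons-edgeSum : ∀ {x} {xs : List (Fin n)} → x ∉ xs →
                   edgeSum X (fromList (x ∷ xs)) ≡ edgeSum X (fromList xs) + 2 * deg X (fromList xs) x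
    cons-edgeSum {x} {xs} x∉ = edgeSum-+⁅⁆ X (fromList-∷-≐ {x = x} {xs} x∉)

    double-suc : ∀ s → 2 * (s + 1) ≡ 2 * s + 2
    double-suc = solve-∀

  path-edgeSum-bound : ∀ x xs → Unique (x ∷ xs) → IsWalk X (x ∷ xs) →
                       2 * size (fromList (x ∷ xs)) ≤ edgeSum X (fromList (x ∷ xs)) + 2
  path-edgeSum-bound x [] uniq _ = subst (λ s → 2 * s ≤ edgeSum X (fromList (x ∷ [])) + 2)
                                      (sym (size-fromList uniq)) (m≤n+m 2 _)
  path-edgeSum-bound x (y ∷ ys) (x∉ ∷ uniq) (xy , walk) = begin
    2 * size (fromList (x ∷ y ∷ ys))          ≡⟨ cong (2 *_) (cons-size x∉′) ⟩
    2 * (size P + 1)                          ≡⟨ double-suc (size P) ⟩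
    2 * size P + 2                            ≤⟨ +-monoˡ-≤ 2 (path-edgeSum-bound y ys uniq walk) ⟩
    edgeSum X P + 2 * 1 + 2                   ≤⟨ +-monoˡ-≤ 2 (+-monoʳ-≤ (edgeSum X P) (*-monoʳ-≤ 2 x-adj-P)) ⟩
    edgeSum X P + 2 * deg X P x + 2           ≡⟨ cong (_+ 2) (cons-edgeSum x∉′) ⟨
    edgeSum X (fromList (x ∷ y ∷ ys)) + 2     ∎
    where
    open ≤-Reasoning
    P = fromList (y ∷ ys)
    x∉′ = Unique[x∷xs]⇒x∉xs (x∉ ∷ uniq)
    x-adj-P : 1 ≤ deg X P x
    x-adj-P = deg-positive X P (∈⇒fromList {xs = y ∷ ys} (here refl)) xy

  cycle-edgeSum-bound : ∀ v L → IsCycle X (v ∷ L) → 2 * size (fromList (v ∷ L)) ≤ edgeSum X (fromList (v ∷ L))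
  cycle-edgeSum-bound v (p ∷ []) (s≤s (s≤s ()) , _)
  cycle-edgeSum-bound v (p ∷ q ∷ rest) (_ , (v∉ ∷ uniq) , (vp , walk) , closes)
    with closing-edge X p q rest closes
  ... | z , z∈ , zv = begin
    2 * size (fromList (v ∷ L))          ≡⟨ cong (2 *_) (cons-size v∉′) ⟩
    2 * (size P + 1)                     ≡⟨ double-suc (size P) ⟩
    2 * size P + 2                       ≤⟨ +-monoˡ-≤ 2 (path-edgeSum-bound p (q ∷ rest) uniq walk) ⟩
    edgeSum X P + 2 + 2                  ≡⟨ +-assoc (edgeSum X P) 2 2 ⟩
    edgeSum X P + 2 * 2                  ≤⟨ +-monoʳ-≤ (edgeSum X P) (*-monoʳ-≤ 2 v-adj-P) ⟩
    edgeSum X P + 2 * deg X P v          ≡⟨ cons-edgeSum v∉′ ⟨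
    edgeSum X (fromList (v ∷ L))         ∎
    where
    open ≤-Reasoning
    L = p ∷ q ∷ rest
    P = fromList L
    v∉′ = Unique[x∷xs]⇒x∉xs (v∉ ∷ uniq)
    p≢z : p ≢ z
    p≢z refl = Unique[x∷xs]⇒x∉xs uniq z∈
    v-adj-P : 2 ≤ deg X P v
    v-adj-P = deg≥2 X P p≢z (∈⇒fromList {xs = L} (here refl)) (∈⇒fromList (there z∈)) vp (trans (adj-sym X v z) zv)

module Components {n k : ℕ} (X : Graph n) (components : HasComponents X k) where

  label : Fin n → Fin k
  label = proj₁ components

  component : Fin k → VertexSet n
  component = fibre label

  private
    label-connected : ∀ u v → (label u ≡ label v) ⇔ Connected X u v
    label-connected = proj₂ (proj₂ components)

    representative : ∀ j → ∃ λ t → label t ≡ j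
    representative j with proj₁ (proj₂ components) j
    ... | t , onto = t , onto refl

    in-component : ∀ {j u} → label u ≡ j → component j u ≡ true
    in-component {u = u} refl = ⁅⁆-self (label u)

  adjacent⇒same-label : ∀ u w → adj X u w ≡ true → label u ≡ label w
  adjacent⇒same-label u w uw = Equivalence.from (label-connected u w) ((u ∷ w ∷ []) , refl , refl , uw , tt)

  walk-in-component : ∀ a as → IsWalk X (a ∷ as) → ∀ {u} → u ∈ a ∷ as → label u ≡ label a
  walk-in-component a as        _            (here refl) = refl
  walk-in-component a (b ∷ bs) (ab , walk) (there u∈)  =
    trans (walk-in-component b bs walk u∈) (sym (adjacent⇒same-label a b ab))

  private
    Extension : Fin k → VertexSet n → Set
    Extension j T = Σ (VertexSet n) λ T′ →
      T′ ⊆ component j × size T′ ≡ size T + 1 × edgeSum X T + 2 ≤ edgeSum X T′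

    fill-or-extend : ∀ j T → T ⊆ component j → 1 ≤ size T → (∀ u → T u ≡ component j u) ⊎ Extension j T
    fill-or-extend j T T⊆S pos with any? (λ u → (component j u B.≟ true) ×-dec (T u B.≟ false))
    ... | no none-missing = inj₁ T≗S
      where
      T≗S : ∀ u → T u ≡ component j u
      T≗S u with T u in u∈?T | component j u in u∈?S
      ... | true  | _     = trans (sym (T⊆S u u∈?T)) u∈?S
      ... | false | false = refl
      ... | false | true  = ⊥-elim (none-missing (u , u∈?S , u∈?T))
    ... | yes (u , u∈S , u∉T) with size-positive T pos
    ...   | t , t∈T with connected-crossing-edge X T (Equivalence.to (label-connected t u) same-label) t∈T u∉T
      where
      same-label : label t ≡ label u
      same-label = trans (∈⁅⁆ j (label t) (T⊆S t t∈T)) (sym (∈⁅⁆ j (label u) u∈S))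
    ...     | x , y , x∈T , y∉T , xy =
      inj₂ (insert y T , insert-⊆ T y T⊆S y∈S , insert-neighbour X T x∈T y∉T (trans (adj-sym X y x) xy))
      where
      y∈S : component j y ≡ true
      y∈S = in-component (trans (sym (adjacent⇒same-label x y xy)) (∈⁅⁆ j (label x) (T⊆S x x∈T)))

    excess-step : ∀ {e e′} {s eS t} → e + 2 ≤ e′ → e′ + 2 * s ≤ eS + 2 * (t + 1) → e + 2 * s ≤ eS + 2 * t
    excess-step {e} {e′} {s} {eS} {t} grown ih = +-cancelʳ-≤ 2 _ _ (begin
      e + 2 * s + 2       ≡⟨ xy∙z≈xz∙y e (2 * s) 2 ⟩
      e + 2 + 2 * s       ≤⟨ +-monoˡ-≤ (2 * s) grown ⟩
      e′ + 2 * s          ≤⟨ ih ⟩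
      eS + 2 * (t + 1)    ≡⟨ expand eS t ⟩
      eS + 2 * t + 2      ∎)
      where
      open ≤-Reasoning
      expand : ∀ a t → a + 2 * (t + 1) ≡ a + 2 * t + 2
      expand = solve-∀

  -- Inside a component T can be grown one neighbour at a time, each step adding a vertex and at least one edge.
  component-excess : ∀ j m T → T ⊆ component j → size (component j) ≤ size T + m → 1 ≤ size T →
                     edgeSum X T + 2 * size (component j) ≤ edgeSum X (component j) + 2 * size T
  component-excess j m T T⊆S S≤T+m pos with fill-or-extend j T T⊆S pos
  ... | inj₁ T≗S = ≤-reflexive (cong₂ _+_ (edgeSum-cong X T≗S) (cong (2 *_) (size-cong (sym ∘ T≗S))))
  ... | inj₂ (T′ , T′⊆S , size-T′ , grown) with m
  ...   | zero   = ⊥-elim (<⇒≱ T<T′ (≤-trans (size-mono T′⊆S) (subst (size (component j) ≤_) (+-identityʳ _) S≤T+m)))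
    where
    T<T′ : size T < size T′
    T<T′ = subst (size T <_) (sym (trans size-T′ (+-comm (size T) 1))) (n<1+n (size T))
  ...   | suc m′ = excess-step {s = size (component j)} {edgeSum X (component j)} {size T} grown
                     (subst (λ t → edgeSum X T′ + 2 * size (component j) ≤ edgeSum X (component j) + 2 * t) size-T′
                       (component-excess j m′ T′ T′⊆S S≤T′+m′ (subst (1 ≤_) (sym size-T′) (m≤n+m 1 (size T)))))
    where
    S≤T′+m′ : size (component j) ≤ size T′ + m′
    S≤T′+m′ = subst (size (component j) ≤_)
                (trans (+-suc (size T) m′) (cong (_+ m′) (trans (+-comm 1 (size T)) (sym size-T′)))) S≤T+m

  component-lower-bound : ∀ j → 2 * size (component j) ≤ edgeSum X (component j) + 2
  component-lower-bound j with representative j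
  ... | t , refl = subst₂ (λ e s → e + 2 * size (component j) ≤ edgeSum X (component j) + 2 * s)
    (edgeSum-⁅⁆ X t) (size-⁅⁆ t)
    (component-excess j n ⁅ t ⁆ ⁅t⁆⊆S (subst (size (component j) ≤_) (cong (_+ n) (sym (size-⁅⁆ t)))
                                            (≤-trans (size≤n (component j)) (m≤n+m n 1)))
                                     (≤-reflexive (sym (size-⁅⁆ t))))
    where
    ⁅t⁆⊆S : ⁅ t ⁆ ⊆ component j
    ⁅t⁆⊆S u u∈ = in-component (cong label (∈⁅⁆ t u u∈))

  cyclic-component : ∀ v L → IsCycle X (v ∷ L) → 2 * size (component (label v)) ≤ edgeSum X (component (label v))
  cyclic-component v L cycle@(_ , _ , walk , _) = +-cancelʳ-≤ (2 * size C) _ _ (begin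
    2 * size S + 2 * size C    ≤⟨ +-monoʳ-≤ (2 * size S) (cycle-edgeSum-bound X v L cycle) ⟩
    2 * size S + edgeSum X C   ≡⟨ +-comm (2 * size S) _ ⟩
    edgeSum X C + 2 * size S   ≤⟨ component-excess (label v) n C C⊆S (≤-trans (size≤n S) (m≤n+m n (size C)))
                                    (∈⇒size-positive C (∈⇒fromList {xs = v ∷ L} (here refl))) ⟩
    edgeSum X S + 2 * size C   ∎)
    where
    open ≤-Reasoning
    C = fromList (v ∷ L)
    S = component (label v)
    C⊆S : C ⊆ S
    C⊆S u u∈ = in-component (walk-in-component v L walk (fromList⇒∈ (v ∷ L) u∈))

  private
    sum-component-sizes : sum (λ j → 2 * size (component j)) ≡ 2 * n
    sum-component-sizes = trans (sym (*-distribˡ-sum 2 (λ j → size (component j)))) (cong (2 *_) (sum-size-fibres label))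

    sum-component-edges : sum (λ j → edgeSum X (component j) + 2) ≡ edgeSum X full + 2 * k
    sum-component-edges = begin
      sum (λ j → edgeSum X (component j) + 2)
        ≡⟨ ∑-distrib-+ (λ j → edgeSum X (component j)) (λ _ → 2) ⟩
      sum (λ j → edgeSum X (component j)) + sum {k} (λ _ → 2)
        ≡⟨ cong₂ _+_ (sum-edgeSum-fibres X label adjacent⇒same-label) (sum-const k 2) ⟩
      edgeSum X full + k * 2
        ≡⟨ cong (edgeSum X full +_) (*-comm k 2) ⟩
      edgeSum X full + 2 * k                                    ∎
      where open ≡-Reasoning

  forest-edge-count : IsForest X → edgeSum X full + 2 * k ≤ 2 * n
  forest-edge-count X-forest = begin
    edgeSum X full + 2 * k                     ≡⟨ sum-component-edges ⟨
    sum (λ j → edgeSum X (component j) + 2)    ≤⟨ sum-mono-≤ _ _ component-bound ⟩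
    sum (λ j → 2 * size (component j))         ≡⟨ sum-component-sizes ⟩
    2 * n                                      ∎
    where
    open ≤-Reasoning
    component-bound : ∀ j → edgeSum X (component j) + 2 ≤ 2 * size (component j)
    component-bound j with representative j
    ... | t , refl = forest-edgeSum-bound X X-forest (component j) (∈⇒size-positive (component j) (in-component refl))

  cyclic-edge-count : ∀ v L → IsCycle X (v ∷ L) → 2 * n + 2 ≤ edgeSum X full + 2 * k
  cyclic-edge-count v L cycle = begin
    2 * n + 2                                  ≡⟨ cong (_+ 2) sum-component-sizes ⟨
    sum (λ j → 2 * size (component j)) + 2     ≤⟨ sum-mono-≤-with-gap _ _ (label v) 2 component-lower-bound
                                                    (+-monoˡ-≤ 2 (cyclic-component v L cycle)) ⟩
    sum (λ j → edgeSum X (component j) + 2)    ≡⟨ sum-component-edges ⟩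
    edgeSum X full + 2 * k                     ∎
    where open ≤-Reasoning

module _ {n : ℕ} (X : Graph (suc n)) (v : Fin (suc n)) where

  private
    π : Fin n → Fin (suc n)
    π = punchIn v

  adjForm-card : ∀ p q → p v ≡ 0 → q v ≡ 0 → adjForm X p q ≡ adjForm (card X v) (p ∘ π) (q ∘ π)
  adjForm-card p q p[v]≡0 q[v]≡0 = begin
    adjForm X p q
      ≡⟨ sum-remove {i = v} (λ u → p u * row u) ⟩
    p v * row v + sum (λ u → p (π u) * row (π u))
      ≡⟨ cong₂ _+_ (cong (_* row v) p[v]≡0) (sum-cong-≗ (λ u → cong (p (π u) *_) (row-card u))) ⟩
    adjForm (card X v) (p ∘ π) (q ∘ π)           ∎
    where
    open ≡-Reasoning
    row : Fin (suc n) → ℕ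
    row u = sum (λ w → q w * adjℕ X u w)
    row-card : ∀ u → row (π u) ≡ sum (λ w → q (π w) * adjℕ X (π u) (π w))
    row-card u = trans (sum-remove {i = v} (λ w → q w * adjℕ X (π u) w))
                       (cong (λ a → a * adjℕ X (π u) v + sum (λ w → q (π w) * adjℕ X (π u) (π w))) q[v]≡0)

  size-card : ∀ S → S v ≡ false → size S ≡ size (S ∘ π)
  size-card S v∉S = trans (sum-remove {i = v} (ind S)) (cong (λ b → ⟦ b ⟧ + size (S ∘ π)) v∉S)

  edgeSum-card : ∀ S → S v ≡ false → edgeSum X S ≡ edgeSum (card X v) (S ∘ π)
  edgeSum-card S v∉S = adjForm-card (ind S) (ind S) (cong ⟦_⟧ v∉S) (cong ⟦_⟧ v∉S)

  edgeSum-full-card : edgeSum X full ≡ edgeSum (card X v) full + 2 * deg X full v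
  edgeSum-full-card = begin
    edgeSum X full
      ≡⟨ edgeSum-+⁅⁆ X (remove-≐ full v refl) ⟩
    edgeSum X R + 2 * deg X R v
      ≡⟨ cong₂ (λ e d → e + 2 * d) card-side (deg-remove-self X full v) ⟩
    edgeSum (card X v) full + 2 * deg X full v               ∎
    where
    open ≡-Reasoning
    R = remove v full
    card-side : edgeSum X R ≡ edgeSum (card X v) full
    card-side = trans (edgeSum-card R (remove-self full v))
                      (edgeSum-cong (card X v) (λ u → cong not (⁅⁆-other v (π u) (punchInᵢ≢i v u))))

edgeSum-iso : ∀ {n} (X Y : Graph n) → X ≅ Y → edgeSum X full ≡ edgeSum Y full
edgeSum-iso X Y (f , adj-pres) = sym (begin
  sum (λ u → 1 * sum (λ w → 1 * adjℕ Y u w))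
    ≡⟨ sum-permute (λ u → 1 * sum (λ w → 1 * adjℕ Y u w)) f ⟩
  sum (λ u → 1 * sum (λ w → 1 * adjℕ Y (to u) w))
    ≡⟨ sum-cong-≗ (λ u → cong (1 *_) (sum-permute (λ w → 1 * adjℕ Y (to u) w) f)) ⟩
  sum (λ u → 1 * sum (λ w → 1 * adjℕ Y (to u) (to w)))
    ≡⟨ sum-cong-≗ (λ u → cong (1 *_) (sum-cong-≗ (λ w → cong (λ b → 1 * ⟦ b ⟧) (sym (adj-pres u w))))) ⟩
  edgeSum X full                                       ∎)
  where
  open ≡-Reasoning
  to = Inverse.to f

module _ {n m : ℕ} (X : Graph n) (Y : Graph m) (f : Fin n → Fin m) (f-injective : Injective _≡_ _≡_ f)
         (f-adj : ∀ a b → adj X a b ≡ true → adj Y (f a) (f b) ≡ true) where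

  private
    map-walk : ∀ L → IsWalk X L → IsWalk Y (map f L)
    map-walk []          _          = tt
    map-walk (a ∷ [])    _          = tt
    map-walk (a ∷ b ∷ L) (ab , walk) = f-adj a b ab , map-walk (b ∷ L) walk

    map-closes : ∀ v L → CycleCloses X v L → CycleCloses Y (f v) (map f L)
    map-closes v (z ∷ [])    zv = f-adj z v zv
    map-closes v (a ∷ b ∷ L) cl = map-closes v (b ∷ L) cl

  map-cycle : ∀ v L → IsCycle X (v ∷ L) → IsCycle Y (f v ∷ map f L)
  map-cycle v L (long , uniq , walk , closes) =
    subst (3 ≤_) (sym (length-map f (v ∷ L))) long , map⁺ f-injective uniq ,
    map-walk (v ∷ L) walk , map-closes v L closes

  forest-reflects : IsForest Y → IsForest X
  forest-reflects Y-forest (v ∷ L) cycle = Y-forest (f v ∷ map f L) (map-cycle v L cycle)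

card-forest : ∀ {n} (X : Graph (suc n)) v → IsForest X → IsForest (card X v)
card-forest X v = forest-reflects (card X v) X (punchIn v) (punchIn-injective v _ _) (λ _ _ uv → uv)

iso-forest : ∀ {n} (X Y : Graph n) → X ≅ Y → IsForest X → IsForest Y
iso-forest X Y (f , adj-pres) = forest-reflects Y X from (Injection.injective (↔⇒↣ (↔-sym f))) from-adj
  where
  from = Inverse.from f
  from-adj : ∀ a b → adj Y a b ≡ true → adj X (from a) (from b) ≡ true
  from-adj a b ab = trans (adj-pres (from a) (from b))
    (trans (cong₂ (adj Y) (Inverse.strictlyInverseˡ f a) (Inverse.strictlyInverseˡ f b)) ab)

image : ∀ {m n} → (Fin m → Fin n) → VertexSet n
image x v = does (any? (λ i → x i ≟ v))

module _ {m n : ℕ} (x : Fin m → Fin n) (x-injective : Injective _≡_ _≡_ x) where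

  ∈image : ∀ i → image x (x i) ≡ true
  ∈image i with any? (λ j → x j ≟ x i)
  ... | yes _     = refl
  ... | no ∉image = ⊥-elim (∉image (i , refl))

  private
    count-preimages : ∀ v → sum (λ i → ind ⁅ x i ⁆ v) ≡ ind (image x) v
    count-preimages v with any? (λ i → x i ≟ v)
    ... | no ∉image    = sum-zeros _ (λ i → cong ⟦_⟧ (⁅⁆-other (x i) v (λ v≡xi → ∉image (i , sym v≡xi))))
    ... | yes (i , refl) = trans (sum-supported-at _ i (λ j j≢i → cong ⟦_⟧ (⁅⁆-other (x j) (x i) (j≢i ∘ x-injective ∘ sym))))
                                (cong ⟦_⟧ (⁅⁆-self (x i)))

  sum-image : ∀ (g : Fin n → ℕ) → sum (λ i → g (x i)) ≡ sum (λ v → ind (image x) v * g v)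
  sum-image g = begin
    sum (λ i → g (x i))
      ≡⟨ sum-cong-≗ (λ i → sym (sum-⁅⁆ (x i) g)) ⟩
    sum (λ i → sum (λ v → ind ⁅ x i ⁆ v * g v))
      ≡⟨ ∑-comm (λ i v → ind ⁅ x i ⁆ v * g v) ⟩
    sum (λ v → sum (λ i → ind ⁅ x i ⁆ v * g v))
      ≡⟨ sum-cong-≗ (λ v → sym (*-distribʳ-sum (g v) (λ i → ind ⁅ x i ⁆ v))) ⟩
    sum (λ v → sum (λ i → ind ⁅ x i ⁆ v) * g v)
      ≡⟨ sum-cong-≗ (λ v → cong (_* g v) (count-preimages v)) ⟩
    sum (λ v → ind (image x) v * g v)                 ∎
    where open ≡-Reasoning

  size-image : size (image x) ≡ m
  size-image = begin
    size (image x)                        ≡⟨ sum-cong-≗ (λ v → sym (*-identityʳ (ind (image x) v))) ⟩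
    sum (λ v → ind (image x) v * 1)       ≡⟨ sum-image (λ _ → 1) ⟨
    sum {m} (λ _ → 1)                     ≡⟨ sum-const m 1 ⟩
    m * 1                                 ≡⟨ *-identityʳ m ⟩
    m                                     ∎
    where open ≡-Reasoning

degreeSum : ∀ {n} → Graph n → VertexSet n → ℕ
degreeSum X S = sum (λ v → ind S v * deg X full v)

ind+ind-∁ : ∀ {n} (S : VertexSet n) v → ind S v + ind (∁ S) v ≡ 1
ind+ind-∁ S v with S v
... | true  = refl
... | false = refl

size-∁ : ∀ {n} (S : VertexSet n) → size S + size (∁ S) ≡ n
size-∁ {n} S = begin
  size S + size (∁ S)                  ≡⟨ ∑-distrib-+ (ind S) (ind (∁ S)) ⟨
  sum (λ v → ind S v + ind (∁ S) v)    ≡⟨ sum-cong-≗ (ind+ind-∁ S) ⟩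
  sum {n} (λ _ → 1)                    ≡⟨ sum-const n 1 ⟩
  n * 1                                ≡⟨ *-identityʳ n ⟩
  n                                    ∎
  where open ≡-Reasoning

degree-identity : ∀ {n} (X : Graph n) S → 2 * degreeSum X S + edgeSum X (∁ S) ≡ edgeSum X full + edgeSum X S
degree-identity X S = begin
  2 * adjForm X s 𝟙 + adjForm X t t              ≡⟨ cong (λ d → 2 * d + adjForm X t t) (split-right s) ⟩
  2 * (ss + st) + cc                             ≡⟨ regroup ss st cc ⟩
  (ss + st) + (st + cc) + ss                     ≡⟨ cong (λ z → (ss + st) + (z + cc) + ss) (adjForm-sym X s t) ⟩
  (ss + st) + (adjForm X t s + cc) + ss           ≡⟨ cong (_+ ss) split-full ⟨
  edgeSum X full + ss                            ∎
  where
  open ≡-Reasoning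
  s = ind S
  t = ind (∁ S)
  𝟙 = ind full
  ss = adjForm X s s
  st = adjForm X s t
  cc = adjForm X t t
  regroup : ∀ a b c → 2 * (a + b) + c ≡ (a + b) + (b + c) + a
  regroup = solve-∀
  split-right : ∀ p → adjForm X p 𝟙 ≡ adjForm X p s + adjForm X p t
  split-right p = trans (adjForm-cong X {p} {p} {𝟙} {λ v → s v + t v} (λ _ → refl) (λ v → sym (ind+ind-∁ S v)))
                        (adjForm-linʳ X p s t)
  split-full : adjForm X 𝟙 𝟙 ≡ (ss + st) + (adjForm X t s + cc)
  split-full = trans (adjForm-cong X {𝟙} {λ v → s v + t v} {𝟙} {𝟙} (λ v → sym (ind+ind-∁ S v)) (λ _ → refl))
                     (trans (adjForm-linˡ X s t 𝟙) (cong₂ _+_ (split-right s) (split-right t)))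

module _ {n : ℕ} (X : Graph n) where

  degreeSum-lower-bound : IsForest X → ∀ S → 1 ≤ size (∁ S) →
                          edgeSum X full + 2 ≤ 2 * degreeSum X S + 2 * size (∁ S)
  degreeSum-lower-bound X-forest S pos = begin
    edgeSum X full + 2
      ≤⟨ +-monoˡ-≤ 2 (m≤m+n _ (edgeSum X S)) ⟩
    edgeSum X full + edgeSum X S + 2
      ≡⟨ cong (_+ 2) (degree-identity X S) ⟨
    2 * degreeSum X S + edgeSum X (∁ S) + 2
      ≡⟨ +-assoc (2 * degreeSum X S) _ 2 ⟩
    2 * degreeSum X S + (edgeSum X (∁ S) + 2)
      ≤⟨ +-monoʳ-≤ (2 * degreeSum X S) (forest-edgeSum-bound X X-forest (∁ S) pos) ⟩
    2 * degreeSum X S + 2 * size (∁ S)             ∎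
    where open ≤-Reasoning

module _ {n : ℕ} (X : Graph (suc n)) {y : Fin (suc n)} (X-y-forest : IsForest (card X y)) where

  card-edgeSum-bound : ∀ R → R y ≡ false → 1 ≤ size R → edgeSum X R + 2 ≤ 2 * size R
  card-edgeSum-bound R y∉R pos =
    subst₂ (λ e s → e + 2 ≤ 2 * s) (sym (edgeSum-card X y R y∉R)) (sym (size-card X y R y∉R))
    (forest-edgeSum-bound (card X y) X-y-forest (R ∘ punchIn y) (subst (1 ≤_) (size-card X y R y∉R) pos))

  degreeSum-upper-bound : ∀ S → S y ≡ true → 1 ≤ size (remove y S) →
                          2 * degreeSum X S + 2 ≤ edgeSum X full + 4 * size (remove y S)
  degreeSum-upper-bound S y∈S pos = begin
    2 * degreeSum X S + 2                      ≤⟨ +-monoˡ-≤ 2 (m≤m+n _ (edgeSum X (∁ S))) ⟩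
    2 * degreeSum X S + edgeSum X (∁ S) + 2    ≡⟨ cong (_+ 2) (degree-identity X S) ⟩
    edgeSum X full + edgeSum X S + 2           ≡⟨ +-assoc (edgeSum X full) (edgeSum X S) 2 ⟩
    edgeSum X full + (edgeSum X S + 2)         ≤⟨ +-monoʳ-≤ (edgeSum X full) S-bound ⟩
    edgeSum X full + 4 * size R                ∎
    where
    open ≤-Reasoning
    R = remove y S
    double-double : ∀ r → 2 * r + 2 * r ≡ 4 * r
    double-double = solve-∀
    S-bound : edgeSum X S + 2 ≤ 4 * size R
    S-bound = begin
      edgeSum X S + 2                  ≡⟨ cong (_+ 2) (edgeSum-+⁅⁆ X (remove-≐ S y y∈S)) ⟩
      edgeSum X R + 2 * deg X R y + 2  ≤⟨ +-monoˡ-≤ 2 (+-monoʳ-≤ (edgeSum X R) (*-monoʳ-≤ 2 (deg≤size X R y))) ⟩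
      edgeSum X R + 2 * size R + 2     ≡⟨ xy∙z≈xz∙y (edgeSum X R) (2 * size R) 2 ⟩
      edgeSum X R + 2 + 2 * size R     ≤⟨ +-monoˡ-≤ (2 * size R) (card-edgeSum-bound R (remove-self S y) pos) ⟩
      2 * size R + 2 * size R          ≡⟨ double-double (size R) ⟩
      4 * size R                       ∎

degreeSum-image : ∀ {m n} (X : Graph n) (x : Fin m → Fin n) → Injective _≡_ _≡_ x →
                  2 * degreeSum X (image x) ≡ sum (λ i → 2 * deg X full (x i))
degreeSum-image X x x-injective = begin
  2 * degreeSum X (image x)                ≡⟨ cong (2 *_) (sum-image x x-injective (deg X full)) ⟨
  2 * sum (λ i → deg X full (x i))         ≡⟨ *-distribˡ-sum 2 (λ i → deg X full (x i)) ⟩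
  sum (λ i → 2 * deg X full (x i))         ∎
  where open ≡-Reasoning

common-card-degrees : ∀ {n} (X Y : Graph (suc n)) x y → card X x ≅ card Y y →
                      edgeSum X full + 2 * deg Y full y ≡ edgeSum Y full + 2 * deg X full x
common-card-degrees X Y x y X-x≅Y-y = begin
  edgeSum X full + 2 * dY
    ≡⟨ cong (_+ 2 * dY) (edgeSum-full-card X x) ⟩
  edgeSum (card X x) full + 2 * dX + 2 * dY
    ≡⟨ cong (λ e → e + 2 * dX + 2 * dY) (edgeSum-iso (card X x) (card Y y) X-x≅Y-y) ⟩
  edgeSum (card Y y) full + 2 * dX + 2 * dY
    ≡⟨ xy∙z≈xz∙y (edgeSum (card Y y) full) (2 * dX) (2 * dY) ⟩
  edgeSum (card Y y) full + 2 * dY + 2 * dX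
    ≡⟨ cong (_+ 2 * dX) (edgeSum-full-card Y y) ⟨
  edgeSum Y full + 2 * dX                              ∎
  where
  open ≡-Reasoning
  dX = deg X full x
  dY = deg Y full y

matched-degree-sums : ∀ {m n} (X Y : Graph (suc n)) (x y : Fin m → Fin (suc n)) →
                      Injective _≡_ _≡_ x → Injective _≡_ _≡_ y → (∀ i → card X (x i) ≅ card Y (y i)) →
                      2 * degreeSum Y (image y) + m * edgeSum X full ≡ m * edgeSum Y full + 2 * degreeSum X (image x)
matched-degree-sums {m} X Y x y x-injective y-injective cards = begin
  2 * degreeSum Y (image y) + m * a
    ≡⟨ cong₂ _+_ (degreeSum-image Y y y-injective) (sym (sum-const m a)) ⟩
  sum (λ i → 2 * deg Y full (y i)) + sum {m} (λ _ → a)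
    ≡⟨ ∑-distrib-+ (λ i → 2 * deg Y full (y i)) (λ _ → a) ⟨
  sum (λ i → 2 * deg Y full (y i) + a)
    ≡⟨ sum-cong-≗ (λ i → trans (+-comm _ a) (common-card-degrees X Y (x i) (y i) (cards i))) ⟩
  sum (λ i → b + 2 * deg X full (x i))
    ≡⟨ ∑-distrib-+ (λ _ → b) (λ i → 2 * deg X full (x i)) ⟩
  sum {m} (λ _ → b) + sum (λ i → 2 * deg X full (x i))
    ≡⟨ cong₂ _+_ (sum-const m b) (sym (degreeSum-image X x x-injective)) ⟩
  m * b + 2 * degreeSum X (image x)                      ∎
  where
  open ≡-Reasoning
  a = edgeSum X full
  b = edgeSum Y full

half-bounds : ∀ n → 2 ≤ n → 1 ≤ suc n / 2 × suc n ≤ 2 * (suc n / 2) + 1 × suc n / 2 + 2 ≤ suc n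
half-bounds n n≥2 = m≥n⇒m/n>0 (s≤s (≤-trans (s≤s z≤n) n≥2)) , upper , lower (suc n / 2) (m/n*n≤m (suc n) 2)
  where
  upper : suc n ≤ 2 * (suc n / 2) + 1
  upper = begin
    suc n                          ≡⟨ m≡m%n+[m/n]*n (suc n) 2 ⟩
    suc n % 2 + suc n / 2 * 2      ≤⟨ +-monoˡ-≤ _ (≤-pred (m%n<n (suc n) 2)) ⟩
    1 + suc n / 2 * 2              ≡⟨ +-comm 1 _ ⟩
    suc n / 2 * 2 + 1              ≡⟨ cong (_+ 1) (*-comm (suc n / 2) 2) ⟩
    2 * (suc n / 2) + 1            ∎
    where open ≤-Reasoning
  lower : ∀ q → q * 2 ≤ suc n → q + 2 ≤ suc n
  lower zero          _     = ≤-trans (s≤s (s≤s z≤n)) (s≤s (≤-trans (s≤s z≤n) n≥2))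
  lower (suc zero)    _     = s≤s n≥2
  lower (suc (suc q)) 2q≤N  = ≤-trans (subst₂ _≤_ (eq₁ q) (eq₂ q) (m≤m+n (q + 4) q)) 2q≤N
    where
    eq₁ : ∀ q → q + 4 ≡ suc (suc q) + 2
    eq₁ = solve-∀
    eq₂ : ∀ q → q + 4 + q ≡ suc (suc q) * 2
    eq₂ = solve-∀

half-complement : ∀ n → 2 ≤ n → (S : VertexSet (suc n)) → size S ≡ suc n / 2 + 1 →
                  1 ≤ size (∁ S) × size (∁ S) ≤ suc n / 2
half-complement n n≥2 S size-S with half-bounds n n≥2
... | _ , N≤2q+1 , q+2≤N = +-cancelˡ-≤ (q + 1) 1 r (subst₂ _≤_ (sym (+-assoc q 1 1)) N≡q+1+r q+2≤N) ,
                           +-cancelˡ-≤ (q + 1) r q (subst₂ _≤_ N≡q+1+r (double+1 q) N≤2q+1)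
  where
  q = suc n / 2
  r = size (∁ S)
  N≡q+1+r : suc n ≡ q + 1 + r
  N≡q+1+r = sym (trans (cong (_+ r) (sym size-S)) (size-∁ S))
  double+1 : ∀ q → 2 * q + 1 ≡ q + 1 + q
  double+1 = solve-∀

private
  edge-gap-arithmetic : ∀ {a b q r dF dG} → a + 6 ≤ b → r ≤ q → dG + (q + 1) * a ≡ (q + 1) * b + dF →
                        dG + 2 ≤ b + 4 * q → a + 2 ≤ dF + 2 * r → ⊥
  edge-gap-arithmetic {a} {b} {q} {r} {dF} {dG} gap r≤q sums upper lower = <-irrefl refl (begin-strict
    q * (a + 6) + c
      <⟨ m<m+n (q * (a + 6) + c) {4} (s≤s z≤n) ⟩
    q * (a + 6) + c + 4
      ≤⟨ +-monoˡ-≤ 4 (+-monoˡ-≤ c (*-monoʳ-≤ q gap)) ⟩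
    q * b + c + 4
      ≡⟨ regroup₁ q a b dF ⟩
    (q + 1) * b + dF + (a + 4)
      ≡⟨ cong (_+ (a + 4)) sums ⟨
    dG + (q + 1) * a + (a + 4)
      ≡⟨ regroup₂ q a dG ⟩
    (dG + 2) + ((q + 1) * a + (a + 2))
      ≤⟨ +-mono-≤ upper (+-monoʳ-≤ ((q + 1) * a) lower) ⟩
    (b + 4 * q) + ((q + 1) * a + (dF + 2 * r))
      ≤⟨ +-monoʳ-≤ (b + 4 * q) (+-monoʳ-≤ ((q + 1) * a) (+-monoʳ-≤ dF (*-monoʳ-≤ 2 r≤q))) ⟩
    (b + 4 * q) + ((q + 1) * a + (dF + 2 * q))
      ≡⟨ regroup₃ q a b dF ⟩
    q * (a + 6) + c                        ∎)
    where
    open ≤-Reasoning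
    c = b + a + dF
    regroup₁ : ∀ q a b f → q * b + (b + a + f) + 4 ≡ (q + 1) * b + f + (a + 4)
    regroup₁ = solve-∀
    regroup₂ : ∀ q a g → g + (q + 1) * a + (a + 4) ≡ (g + 2) + ((q + 1) * a + (a + 2))
    regroup₂ = solve-∀
    regroup₃ : ∀ q a b f → (b + 4 * q) + ((q + 1) * a + (f + 2 * q)) ≡ q * (a + 6) + (b + a + f)
    regroup₃ = solve-∀

common-cards-edge-gap : ∀ n → 2 ≤ n → (F G : Graph (suc n)) → IsForest F →
                        CommonCardsAtLeast (suc n / 2 + 1) F G → ¬ (edgeSum F full + 6 ≤ edgeSum G full)
common-cards-edge-gap n n≥2 F G F-forest (x , y , x-injective , y-injective , cards) gap =
  edge-gap-arithmetic gap (proj₂ complement) (matched-degree-sums F G x y x-injective y-injective cards) upper lower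
  where
  q = suc n / 2
  Xs = image x
  Ys = image y
  y₀ = y (fromℕ< (m≤n+m 1 q))
  R = remove y₀ Ys

  size-R : size R ≡ q
  size-R = +-cancelʳ-≡ 1 _ _
    (trans (sym (size-+⁅⁆ (remove-≐ Ys y₀ (∈image y y-injective _)))) (size-image y y-injective))

  complement : 1 ≤ size (∁ Xs) × size (∁ Xs) ≤ q
  complement = half-complement n n≥2 Xs (size-image x x-injective)

  upper : 2 * degreeSum G Ys + 2 ≤ edgeSum G full + 4 * q
  upper = subst (λ s → 2 * degreeSum G Ys + 2 ≤ edgeSum G full + 4 * s) size-R
    (degreeSum-upper-bound G G-y₀-forest Ys (∈image y y-injective _)
      (subst (1 ≤_) (sym size-R) (proj₁ (half-bounds n n≥2))))
    where
    G-y₀-forest : IsForest (card G y₀)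
    G-y₀-forest = iso-forest _ _ (cards _) (card-forest F _ F-forest)

  lower : edgeSum F full + 2 ≤ 2 * degreeSum F Xs + 2 * size (∁ Xs)
  lower = degreeSum-lower-bound F F-forest Xs (proj₁ complement)

components-edge-gap : ∀ {n kF kG} (F G : Graph n) → IsForest F → HasComponents F kF → HasComponents G kG →
                      ∀ v L → IsCycle G (v ∷ L) → kG + 2 ≤ kF → edgeSum F full + 6 ≤ edgeSum G full
components-edge-gap {n} {kF} {kG} F G F-forest F-components G-components v L cycle kG+2≤kF =
  +-cancelʳ-≤ (2 * kG) _ _ (begin
    edgeSum F full + 6 + 2 * kG          ≡⟨ regroup (edgeSum F full) kG ⟩
    edgeSum F full + 2 * (kG + 2) + 2    ≤⟨ +-monoˡ-≤ 2 (+-monoʳ-≤ (edgeSum F full) (*-monoʳ-≤ 2 kG+2≤kF)) ⟩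
    edgeSum F full + 2 * kF + 2          ≤⟨ +-monoˡ-≤ 2 (Components.forest-edge-count F F-components F-forest) ⟩
    2 * n + 2                            ≤⟨ Components.cyclic-edge-count G G-components v L cycle ⟩
    edgeSum G full + 2 * kG              ∎)
  where
  open ≤-Reasoning
  regroup : ∀ a k → a + 6 + 2 * k ≡ a + 2 * (k + 2) + 2
  regroup = solve-∀

lemma6 : (n : ℕ) → 2 ≤ n → (F G : Graph (suc n)) →
         IsForest F → ¬ IsForest G →
         CommonCardsAtLeast (suc n / 2 + 1) F G →
         (kF kG : ℕ) → HasComponents F kF → HasComponents G kG →
         kF ≤ kG + 1
lemma6 n n≥2 F G F-forest G-not-forest common kF kG F-components G-components with kF ≤? kG + 1
... | yes kF≤kG+1 = kF≤kG+1
... | no  kF≰kG+1 = ⊥-elim (G-not-forest G-forest)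
  where
  G-forest : IsForest G
  G-forest (v ∷ L) cycle = common-cards-edge-gap n n≥2 F G F-forest common
    (components-edge-gap F G F-forest F-components G-components v L cycle
      (subst (_≤ kF) (sym (+-suc kG 1)) (≰⇒> kF≰kG+1)))
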